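{- Let $n \geq 2$ and let $D = (d_1, \ldots, d_n)$ be a nondecreasing sequence of nonnegative integers. Then $e(D) = \lceil d_n/(n-1) \rceil$.
   Context: A loopless directed multigraph on players $P_1,\ldots,P_n$ is given by nonnegative integers $m_{ij}$ with $m_{ii}=0$ ($m_{ij}$ = number of arcs from $P_i$ to $P_j$); its out-degree sequence is $(d_1,\ldots,d_n)$ with $d_i=\sum_j m_{ij}$. For such a $T$ let $E(T) = \max_{1\le i,j\le n} m_{ij}$. Let $\Delta(D)$ be the set of all loopless directed multigraphs with out-degree sequence $D$, and $e(D) = \min\{E(T) : T \in \Delta(D)\}$. -}

module Defs where

open import Data.Nat using (ℕ; zero; suc; _+_; _∸_; _≤_; _⊔_; NonZero)
open import Data.Nat.DivMod using (_/_)
open import Data.Fin using (Fin; zero; suc)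
import Data.Fin as F
open import Data.Product using (Σ; _×_)
open import Relation.Binary.PropositionalEquality using (_≡_)

sumF : ∀ {n} → (Fin n → ℕ) → ℕ
sumF {zero}  f = 0
sumF {suc n} f = f zero + sumF (λ i → f (suc i))

maxF : ∀ {n} → (Fin n → ℕ) → ℕ
maxF {zero}  f = 0
maxF {suc n} f = f zero ⊔ maxF (λ i → f (suc i))

⌈_/_⌉ : ℕ → (b : ℕ) → .{{NonZero b}} → ℕ
⌈ a / b ⌉ = (a + (b ∸ 1)) / b

-- a directed multigraph on players P_1..P_n: m i j = number of arcs from P_i to P_j
Multigraph : ℕ → Set
Multigraph n = Fin n → Fin n → ℕ

Loopless : ∀ {n} → Multigraph n → Set
Loopless m = ∀ i → m i i ≡ 0

outdeg : ∀ {n} → Multigraph n → Fin n → ℕ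
outdeg m i = sumF (m i)

InΔ : ∀ {n} → (Fin n → ℕ) → Multigraph n → Set
InΔ D T = Loopless T × (∀ i → outdeg T i ≡ D i)

E : ∀ {n} → Multigraph n → ℕ
E T = maxF (λ i → maxF (T i))

IsEOf : ∀ {n} → (Fin n → ℕ) → ℕ → Set
IsEOf {n} D k = Σ (Multigraph n) (λ T → InΔ D T × E T ≡ k) × (∀ T → InΔ D T → k ≤ E T)

Nondecreasing : ∀ {n} → (Fin n → ℕ) → Set
Nondecreasing D = ∀ i j → i F.≤ j → D i ≤ D j

module Submission where

open import Defs
open import Data.Nat using (ℕ; zero; suc; _+_; _*_; _∸_; _≤_; _⊓_; z≤n; s≤s; s≤s⁻¹; NonZero)
open import Data.Nat.Properties
open import Data.Nat.DivMod using (_/_; _%_; m≡m%n+[m/n]*n; m%n<n; m<n*o⇒m/o<n)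
open import Data.Fin using (Fin; zero; suc; fromℕ)
open import Data.Fin.Properties using (≤fromℕ)
open import Data.Product using (Σ; _×_; _,_; proj₁; proj₂)
open import Relation.Binary.PropositionalEquality using (_≡_; refl; sym; cong; module ≡-Reasoning)

-- Proof idea.  Write n = k + 2 and c = ⌈ d_n / (n-1) ⌉.
--
-- Lower bound: a loopless row has a zero on the diagonal, so its n-1 other
-- entries carry the whole out-degree; hence d_n ≤ (n-1) · E(T) for every
-- T ∈ Δ(D), i.e. c ≤ E(T).
--
-- Upper bound: every d_i ≤ d_n ≤ (n-1) · c, so row i can be filled greedily
-- from left to right with blocks of at most c arcs, skipping the diagonal.
-- This greedy fill is stated once for an arbitrary capacity vector (it
-- realises any total not exceeding the total capacity) and applied with the
-- capacity "c off the diagonal, 0 on it".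

sumF-mono : ∀ {n} (f g : Fin n → ℕ) → (∀ j → f j ≤ g j) → sumF f ≤ sumF g
sumF-mono {zero}  f g f≤g = z≤n
sumF-mono {suc n} f g f≤g =
  +-mono-≤ (f≤g zero) (sumF-mono (λ j → f (suc j)) (λ j → g (suc j)) (λ j → f≤g (suc j)))

sumF-const : ∀ n c → sumF {n} (λ _ → c) ≡ n * c
sumF-const zero    c = refl
sumF-const (suc n) c = cong (c +_) (sumF-const n c)

maxF-lub : ∀ {n} (f : Fin n → ℕ) c → (∀ j → f j ≤ c) → maxF f ≤ c
maxF-lub {zero}  f c f≤c = z≤n
maxF-lub {suc n} f c f≤c = ⊔-lub (f≤c zero) (maxF-lub (λ j → f (suc j)) c (λ j → f≤c (suc j)))

≤-maxF : ∀ {n} (f : Fin n → ℕ) j → f j ≤ maxF f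
≤-maxF f zero    = m≤m⊔n _ _
≤-maxF f (suc j) = m≤n⇒m≤o⊔n (f zero) (≤-maxF (λ j → f (suc j)) j)

entry≤E : ∀ {n} (T : Multigraph n) i j → T i j ≤ E T
entry≤E T i j = ≤-trans (≤-maxF (T i) j) (≤-maxF (λ i → maxF (T i)) i)

E-lub : ∀ {n} (T : Multigraph n) c → (∀ i j → T i j ≤ c) → E T ≤ c
E-lub T c T≤c = maxF-lub _ c (λ i → maxF-lub (T i) c (T≤c i))

⌈⌉-cover : ∀ d N .{{_ : NonZero N}} → d ≤ N * ⌈ d / N ⌉
⌈⌉-cover d (suc n) = +-cancelʳ-≤ n d (suc n * q) (begin
    d + n                     ≡⟨ m≡m%n+[m/n]*n (d + n) (suc n) ⟩
    (d + n) % suc n + q * suc n ≡⟨ +-comm _ (q * suc n) ⟩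
    q * suc n + (d + n) % suc n ≤⟨ +-mono-≤ (≤-reflexive (*-comm q (suc n)))
                                            (s≤s⁻¹ (m%n<n (d + n) (suc n))) ⟩
    suc n * q + n             ∎)
  where
  open ≤-Reasoning
  q = ⌈ d / suc n ⌉

⌈⌉-least : ∀ d N m .{{_ : NonZero N}} → d ≤ N * m → ⌈ d / N ⌉ ≤ m
⌈⌉-least d (suc n) m d≤Nm = s≤s⁻¹ (m<n*o⇒m/o<n {d + n} {suc m} {suc n} (begin-strict
    d + n           <⟨ s≤s (+-monoˡ-≤ n d≤Nm) ⟩
    suc (suc n * m + n) ≡⟨ cong suc (+-comm (suc n * m) n) ⟩
    suc n + suc n * m   ≡⟨ sym (*-suc (suc n) m) ⟩
    suc n * suc m       ≡⟨ *-comm (suc n) (suc m) ⟩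
    suc m * suc n       ∎))
  where open ≤-Reasoning

offAt : ∀ {n} → Fin n → ℕ → Fin n → ℕ
offAt zero    c zero    = 0
offAt zero    c (suc j) = c
offAt (suc i) c zero    = c
offAt (suc i) c (suc j) = offAt i c j

offAt-diag : ∀ {n} (i : Fin n) c → offAt i c i ≡ 0
offAt-diag zero    c = refl
offAt-diag (suc i) c = offAt-diag i c

offAt-≤ : ∀ {n} (i : Fin n) c j → offAt i c j ≤ c
offAt-≤ zero    c zero    = z≤n
offAt-≤ zero    c (suc j) = ≤-refl
offAt-≤ (suc i) c zero    = ≤-refl
offAt-≤ (suc i) c (suc j) = offAt-≤ i c j

sumF-offAt : ∀ {n} (i : Fin (suc n)) c → sumF (offAt i c) ≡ n * c
sumF-offAt {n}     zero    c = sumF-const n c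
sumF-offAt {suc n} (suc i) c = cong (c +_) (sumF-offAt i c)

≤-offAt : ∀ {n} (f : Fin n → ℕ) i M → f i ≡ 0 → (∀ j → f j ≤ M) → ∀ j → f j ≤ offAt i M j
≤-offAt f zero    M fi≡0 f≤M zero    = ≤-reflexive fi≡0
≤-offAt f zero    M fi≡0 f≤M (suc j) = f≤M (suc j)
≤-offAt f (suc i) M fi≡0 f≤M zero    = f≤M zero
≤-offAt f (suc i) M fi≡0 f≤M (suc j) =
  ≤-offAt (λ j → f (suc j)) i M fi≡0 (λ j → f≤M (suc j)) j

outdeg≤ : ∀ {n} (T : Multigraph (suc n)) → Loopless T → ∀ i → outdeg T i ≤ n * E T
outdeg≤ {n} T loopless i = begin
  sumF (T i)            ≤⟨ sumF-mono (T i) (offAt i (E T))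
                             (≤-offAt (T i) i (E T) (loopless i) (entry≤E T i)) ⟩
  sumF (offAt i (E T))  ≡⟨ sumF-offAt i (E T) ⟩
  n * E T               ∎
  where open ≤-Reasoning

e-lower : ∀ {n} .{{_ : NonZero n}} (D : Fin (suc n) → ℕ) i (T : Multigraph (suc n)) →
          InΔ D T → ⌈ D i / n ⌉ ≤ E T
e-lower {n} D i T (loopless , degrees) =
  ⌈⌉-least (D i) n (E T) (≤-trans (≤-reflexive (sym (degrees i))) (outdeg≤ T loopless i))

greedy : ∀ {n} → (Fin n → ℕ) → ℕ → Fin n → ℕ
greedy cap d zero    = cap zero ⊓ d
greedy cap d (suc j) = greedy (λ j → cap (suc j)) (d ∸ cap zero) j

greedy-≤ : ∀ {n} (cap : Fin n → ℕ) d j → greedy cap d j ≤ cap j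
greedy-≤ cap d zero    = m⊓n≤m (cap zero) d
greedy-≤ cap d (suc j) = greedy-≤ (λ j → cap (suc j)) (d ∸ cap zero) j

sumF-greedy : ∀ {n} (cap : Fin n → ℕ) d → d ≤ sumF cap → sumF (greedy cap d) ≡ d
sumF-greedy {zero}  cap d d≤0 = sym (n≤0⇒n≡0 d≤0)
sumF-greedy {suc n} cap d d≤cap = begin
  cap zero ⊓ d + sumF (greedy (λ j → cap (suc j)) (d ∸ cap zero))
    ≡⟨ cong (cap zero ⊓ d +_) (sumF-greedy (λ j → cap (suc j)) (d ∸ cap zero)
                                 (m≤n+o⇒m∸n≤o d (cap zero) d≤cap)) ⟩
  cap zero ⊓ d + (d ∸ cap zero) ≡⟨ m⊓n+n∸m≡n (cap zero) d ⟩
  d ∎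
  where open ≡-Reasoning

realise : ∀ {n} (D : Fin (suc n) → ℕ) c → (∀ i → D i ≤ n * c) →
          Σ (Multigraph (suc n)) (λ T → InΔ D T × E T ≤ c)
realise {n} D c D≤nc = T , (loopless , degrees) , E-lub T c entry≤c
  where
  T : Multigraph (suc n)
  T i = greedy (offAt i c) (D i)
  entry≤c : ∀ i j → T i j ≤ c
  entry≤c i j = ≤-trans (greedy-≤ (offAt i c) (D i) j) (offAt-≤ i c j)
  loopless : Loopless T
  loopless i = n≤0⇒n≡0 (≤-trans (greedy-≤ (offAt i c) (D i) i) (≤-reflexive (offAt-diag i c)))
  degrees : ∀ i → outdeg T i ≡ D i
  degrees i = sumF-greedy (offAt i c) (D i)
                (≤-trans (D≤nc i) (≤-reflexive (sym (sumF-offAt i c))))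

corollary3 : (k : ℕ) → (D : Fin (suc (suc k)) → ℕ) → Nondecreasing D →
    IsEOf D ⌈ D (fromℕ (suc k)) / suc k ⌉
corollary3 k D nondecreasing = (T , T∈Δ , ≤-antisym ET≤c (lower T T∈Δ)) , lower
  where
  last = fromℕ (suc k)
  c = ⌈ D last / suc k ⌉
  lower : ∀ T → InΔ D T → c ≤ E T
  lower = e-lower D last
  D≤c : ∀ i → D i ≤ suc k * c
  D≤c i = ≤-trans (nondecreasing i last (≤fromℕ i)) (⌈⌉-cover (D last) (suc k))
  realised : Σ (Multigraph (suc (suc k))) (λ T → InΔ D T × E T ≤ c)
  realised = realise D c D≤c
  T : Multigraph (suc (suc k))
  T = proj₁ realised
  T∈Δ : InΔ D T
  T∈Δ = proj₁ (proj₂ realised)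
  ET≤c : E T ≤ c
  ET≤c = proj₂ (proj₂ realised)
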